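{- $\ell_{\mathbb{F}_9}\le 32$.
   Context: $\mathbb{F}_9$ is the field with $9$ elements. For $a_1,\dots,a_n\in\mathbb{F}_9$, set $M_n(a_1,\ldots,a_n)=\begin{pmatrix} a_n & -1\\ 1 & 0\end{pmatrix}\cdots\begin{pmatrix} a_1 & -1\\ 1 & 0\end{pmatrix}$. An $n$-tuple $(a_1,\dots,a_n)$ is a $\lambda$-quiddity over $\mathbb{F}_9$ if $M_n(a_1,\dots,a_n)=\pm\mathrm{Id}$. Define $(a_1,\dots,a_n)\oplus(b_1,\dots,b_m)=(a_1+b_m,a_2,\dots,a_{n-1},a_n+b_1,b_2,\dots,b_{m-1})$. Write $\sim$ for equivalence of tuples up to cyclic rotation and reversal. A $\lambda$-quiddity $(c_1,\dots,c_n)$ with $n\ge3$ is reducible if $(c_1,\dots,c_n)\sim(a_1,\dots,a_m)\oplus(b_1,\dots,b_l)$ for some tuple $(a_1,\dots,a_m)$ and some $\lambda$-quiddity $(b_1,\dots,b_l)$, with $m,l\ge3$. It is irreducible otherwise; $(0,0)$ is not considered irreducible. $\ell_{\mathbb{F}_9}$ denotes the maximum size of an irreducible $\lambda$-quiddity over $\mathbb{F}_9$. -}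

module Defs where

open import Data.Nat using (ℕ; zero; suc; _≤_)
open import Data.List using (List; []; _∷_; _++_; length; drop; take; reverse)
open import Data.Vec as Vec using (Vec; head; tail; last; init; toList)
open import Data.Product using (Σ; ∃; _×_; _,_)
open import Data.Sum using (_⊎_)
open import Relation.Binary.PropositionalEquality using (_≡_)
open import Relation.Nullary using (¬_)

data F3 : Set where
  z0 z1 z2 : F3

_+₃_ : F3 → F3 → F3
z0 +₃ y  = y
z1 +₃ z0 = z1
z1 +₃ z1 = z2
z1 +₃ z2 = z0
z2 +₃ z0 = z2
z2 +₃ z1 = z0
z2 +₃ z2 = z1

-₃_ : F3 → F3
-₃ z0 = z0
-₃ z1 = z2
-₃ z2 = z1

_*₃_ : F3 → F3 → F3
z0 *₃ y = z0
z1 *₃ y = y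
z2 *₃ y = -₃ y

-- 𝔽₉ = 𝔽₃[i]/(i² + 1)   (x² + 1 is irreducible over 𝔽₃),
-- element  re + im·i

record F9 : Set where
  constructor _+i_
  field
    re im : F3

open F9 public

_+_ : F9 → F9 → F9
(a +i b) + (c +i d) = (a +₃ c) +i (b +₃ d)

-_ : F9 → F9
- (a +i b) = (-₃ a) +i (-₃ b)

_*_ : F9 → F9 → F9
(a +i b) * (c +i d) = ((a *₃ c) +₃ (-₃ (b *₃ d))) +i ((a *₃ d) +₃ (b *₃ c))

0F 1F : F9
0F = z0 +i z0
1F = z1 +i z0

record Mat2 : Set where
  constructor mat
  field
    m11 m12 m21 m22 : F9

_·_ : Mat2 → Mat2 → Mat2
mat a b c d · mat e f g h =
  mat ((a * e) + (b * g)) ((a * f) + (b * h))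
      ((c * e) + (d * g)) ((c * f) + (d * h))

Id : Mat2
Id = mat 1F 0F 0F 1F

-Id : Mat2
-Id = mat (- 1F) 0F 0F (- 1F)

A : F9 → Mat2
A a = mat a (- 1F) 1F 0F

M : List F9 → Mat2
M []       = Id
M (a ∷ as) = M as · A a

IsQuiddity : List F9 → Set
IsQuiddity c = (M c ≡ Id) ⊎ (M c ≡ -Id)

-- The sum ⊕, for tuples of length ≥ 2:
-- (a₁,…,aₙ) ⊕ (b₁,…,bₘ) = (a₁+bₘ, a₂,…,aₙ₋₁, aₙ+b₁, b₂,…,bₘ₋₁)

_⊕_ : ∀ {p q} → Vec F9 (suc (suc p)) → Vec F9 (suc (suc q)) → List F9
a ⊕ b = (head a + last b) ∷
        (toList (init (tail a)) ++ ((last a + head b) ∷ toList (init (tail b))))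

rotate : ℕ → List F9 → List F9
rotate k c = drop k c ++ take k c

_∼_ : List F9 → List F9 → Set
c ∼ d = ∃ λ k → k ≤ length c × ((d ≡ rotate k c) ⊎ (d ≡ reverse (rotate k c)))

Reducible : List F9 → Set
Reducible c =
  ∃ λ p → ∃ λ q → Σ (Vec F9 (suc (suc (suc p)))) λ a →
    Σ (Vec F9 (suc (suc (suc q)))) λ b →
      IsQuiddity (toList b) × (c ∼ (a ⊕ b))

-- Irreducible λ-quiddity: a λ-quiddity of size n ≥ 3 that is not reducible
-- (this excludes (0,0), the only λ-quiddity of size < 3).
Irreducible : List F9 → Set
Irreducible c = IsQuiddity c × (3 ≤ length c) × ¬ Reducible c

module Submission where

-- Write Mₜ for the monodromy M of the first t entries of c; det Mₜ = 1, and the second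
-- row of Mₜ₊₁ is the first row of Mₜ.  If the monodromy S of a block s of consecutive
-- entries has S₁₁ = ±1, one entry on each side closes s up into a λ-quiddity b, and if
-- at least three entries of c lie outside s then c ∼ a ⊕ b: c is reducible.  So if c is
-- irreducible of length n ≥ 31, then for each of the 26 values 3 ≤ t ≤ 28 no entry of the
-- second row of Mₜ is ±1 (else a block starting at the first or second entry of c
-- qualifies), and no two of these rows agree up to a sign σ: if row₂ Mᵤ = σ row₂ Mₜ with
-- t < u, the monodromy S of the entries t+1, …, u has row₂ S = (0, σ), hence S₁₁ = σ.
-- But pairs with entries in 𝔽₉ ∖ {±1} fall into only 25 classes up to sign.  This even
-- gives ℓ ≤ 30.

open import Defs
open import Level using (Level; 0ℓ)
open import Algebra.Bundles using (CommutativeRing)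
open import Algebra.Structures using (IsCommutativeRing)
open import Data.Empty using (⊥-elim)
open import Data.Fin as Fin using (Fin; toℕ; zero)
open import Data.Fin.Properties using (pigeonhole; toℕ≤pred[n])
open import Data.List
  using (List; []; _∷_; _++_; _∷ʳ_; length; take; drop; map; cartesianProduct; findIndex; lookup)
open import Data.List.Properties using (++-assoc; length-++-≤ˡ; take-[]; take++drop≡id)
open import Data.Maybe using (fromMaybe)
open import Data.Nat as ℕ using (zero; suc; _≤_; _<_; _≤?_; s≤s; z≤n)
open import Data.Nat.Properties as ℕₚ
  using ( ≤-trans; ≤-pred; ≰⇒>; m≤m+n; n≤1+n; n<1+n; +-suc; m≤n⇒∃[o]m+o≡n
        ; +-monoʳ-<; +-monoˡ-≤; +-monoʳ-≤)
open import Data.Product using (_×_; _,_; ∃; ∃₂; proj₁; proj₂)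
open import Data.Product.Properties using (≡-dec)
open import Data.Sum using (_⊎_; inj₁; inj₂)
open import Data.Vec using (Vec; fromList; toList) renaming (_∷_ to _∷ᵥ_; _∷ʳ_ to _∷ʳᵥ_)
open import Data.Vec.Properties using (last-∷ʳ; init-∷ʳ; toList-∷ʳ; toList∘fromList)
open import Function using (case_of_)
open import Relation.Binary.Definitions using (DecidableEquality)
open import Relation.Binary.PropositionalEquality
open import Relation.Nullary using (Dec; yes; no; ¬_)
open import Relation.Nullary.Decidable using (from-yes; map′; _×-dec_; _⊎-dec_; _→-dec_; ¬?; dec⇒maybe)
open import Tactic.RingSolver using (solve-∀)
open import Tactic.RingSolver.Core.AlmostCommutativeRing using (AlmostCommutativeRing; fromCommutativeRing)

private
  variable
    ℓ : Level
    X : Set ℓ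

infix 4 _≟₃_ _≟_ _≟ᴹ_

_≟₃_ : DecidableEquality F3
z0 ≟₃ z0 = yes refl
z1 ≟₃ z1 = yes refl
z2 ≟₃ z2 = yes refl
z0 ≟₃ z1 = no λ ()
z0 ≟₃ z2 = no λ ()
z1 ≟₃ z0 = no λ ()
z1 ≟₃ z2 = no λ ()
z2 ≟₃ z0 = no λ ()
z2 ≟₃ z1 = no λ ()

_≟_ : DecidableEquality F9
(a +i b) ≟ (c +i d) =
  map′ (λ { (refl , refl) → refl }) (λ { refl → refl , refl }) (a ≟₃ c ×-dec b ≟₃ d)

∀₃? : {P : F3 → Set} → (∀ a → Dec (P a)) → Dec (∀ a → P a)
∀₃? P? = map′ (λ { (p₀ , p₁ , p₂) → λ { z0 → p₀ ; z1 → p₁ ; z2 → p₂ } })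
               (λ p → p z0 , p z1 , p z2)
               (P? z0 ×-dec P? z1 ×-dec P? z2)

∀? : {P : F9 → Set} → (∀ x → Dec (P x)) → Dec (∀ x → P x)
∀? P? = map′ (λ p (a +i b) → p a b) (λ p a b → p (a +i b)) (∀₃? λ a → ∀₃? λ b → P? (a +i b))

+-assoc : ∀ x y z → (x + y) + z ≡ x + (y + z)
+-assoc = from-yes (∀? λ x → ∀? λ y → ∀? λ z → (x + y) + z ≟ x + (y + z))

+-comm : ∀ x y → x + y ≡ y + x
+-comm = from-yes (∀? λ x → ∀? λ y → x + y ≟ y + x)

+-identityˡ : ∀ x → 0F + x ≡ x
+-identityˡ = from-yes (∀? λ x → 0F + x ≟ x)

+-identityʳ : ∀ x → x + 0F ≡ x
+-identityʳ = from-yes (∀? λ x → x + 0F ≟ x)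

-‿inverseˡ : ∀ x → (- x) + x ≡ 0F
-‿inverseˡ = from-yes (∀? λ x → (- x) + x ≟ 0F)

-‿inverseʳ : ∀ x → x + (- x) ≡ 0F
-‿inverseʳ = from-yes (∀? λ x → x + (- x) ≟ 0F)

-‿involutive : ∀ x → - (- x) ≡ x
-‿involutive = from-yes (∀? λ x → - (- x) ≟ x)

*-assoc : ∀ x y z → (x * y) * z ≡ x * (y * z)
*-assoc = from-yes (∀? λ x → ∀? λ y → ∀? λ z → (x * y) * z ≟ x * (y * z))

*-comm : ∀ x y → x * y ≡ y * x
*-comm = from-yes (∀? λ x → ∀? λ y → x * y ≟ y * x)

*-identityˡ : ∀ x → 1F * x ≡ x
*-identityˡ = from-yes (∀? λ x → 1F * x ≟ x)

*-identityʳ : ∀ x → x * 1F ≡ x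
*-identityʳ = from-yes (∀? λ x → x * 1F ≟ x)

*-distribˡ-+ : ∀ x y z → x * (y + z) ≡ (x * y) + (x * z)
*-distribˡ-+ = from-yes (∀? λ x → ∀? λ y → ∀? λ z → x * (y + z) ≟ (x * y) + (x * z))

*-distribʳ-+ : ∀ x y z → (y + z) * x ≡ (y * x) + (z * x)
*-distribʳ-+ = from-yes (∀? λ x → ∀? λ y → ∀? λ z → (y + z) * x ≟ (y * x) + (z * x))

+-*-isCommutativeRing : IsCommutativeRing _≡_ _+_ _*_ -_ 0F 1F
+-*-isCommutativeRing = record
  { isRing = record
    { +-isAbelianGroup = record
      { isGroup = record
        { isMonoid = record
          { isSemigroup = record
            { isMagma = record { isEquivalence = isEquivalence ; ∙-cong = cong₂ _+_ }
            ; assoc = +-assoc }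
          ; identity = +-identityˡ , +-identityʳ }
        ; inverse = -‿inverseˡ , -‿inverseʳ
        ; ⁻¹-cong = cong -_ }
      ; comm = +-comm }
    ; *-cong = cong₂ _*_
    ; *-assoc = *-assoc
    ; *-identity = *-identityˡ , *-identityʳ
    ; distrib = *-distribˡ-+ , *-distribʳ-+ }
  ; *-comm = *-comm }

F9-commutativeRing : CommutativeRing 0ℓ 0ℓ
F9-commutativeRing = record { isCommutativeRing = +-*-isCommutativeRing }

F9-ring : AlmostCommutativeRing 0ℓ 0ℓ
F9-ring = fromCommutativeRing F9-commutativeRing λ x → dec⇒maybe (0F ≟ x)

[u-v]+v≡u : ∀ u v → ((u + (- v)) + v) ≡ u
[u-v]+v≡u = solve-∀ F9-ring

IsSign : F9 → Set
IsSign σ = (σ ≡ 1F) ⊎ (σ ≡ - 1F)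

isSign? : ∀ a → Dec (IsSign a)
isSign? a = a ≟ 1F ⊎-dec a ≟ - 1F

IsSign-* : ∀ {σ τ} → IsSign σ → IsSign τ → IsSign (σ * τ)
IsSign-* (inj₁ refl) (inj₁ refl) = inj₁ refl
IsSign-* (inj₁ refl) (inj₂ refl) = inj₂ refl
IsSign-* (inj₂ refl) (inj₁ refl) = inj₂ refl
IsSign-* (inj₂ refl) (inj₂ refl) = inj₁ refl

IsSign-square : ∀ {σ} → IsSign σ → σ * σ ≡ 1F
IsSign-square (inj₁ refl) = refl
IsSign-square (inj₂ refl) = refl

IsSign-neg : ∀ {a} → IsSign (- a) → IsSign a
IsSign-neg {a} (inj₁ -a≡1)  = inj₂ (trans (sym (-‿involutive a)) (cong -_ -a≡1))
IsSign-neg {a} (inj₂ -a≡-1) = inj₁ (trans (sym (-‿involutive a)) (cong -_ -a≡-1))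

mat-cong : ∀ {a b c d a′ b′ c′ d′} → a ≡ a′ → b ≡ b′ → c ≡ c′ → d ≡ d′ →
           mat a b c d ≡ mat a′ b′ c′ d′
mat-cong refl refl refl refl = refl

_≟ᴹ_ : DecidableEquality Mat2
mat a b c d ≟ᴹ mat a′ b′ c′ d′ =
  map′ (λ { (refl , refl , refl , refl) → refl }) (λ { refl → refl , refl , refl , refl })
       (a ≟ a′ ×-dec b ≟ b′ ×-dec c ≟ c′ ×-dec d ≟ d′)

·-assoc : ∀ P Q R → (P · Q) · R ≡ P · (Q · R)
·-assoc (mat a b c d) (mat e f g h) (mat i j k l) =
  mat-cong (entry a b e f g h i k) (entry a b e f g h j l) (entry c d e f g h i k) (entry c d e f g h j l)
  where
  entry : ∀ a b e f g h i k → ((((a * e) + (b * g)) * i) + (((a * f) + (b * h)) * k))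
                              ≡ ((a * ((e * i) + (f * k))) + (b * ((g * i) + (h * k))))
  entry = solve-∀ F9-ring

·-identityˡ : ∀ P → Id · P ≡ P
·-identityˡ (mat a b c d) = mat-cong (unit₁ a c) (unit₁ b d) (unit₂ a c) (unit₂ b d)
  where
  unit₁ : ∀ a c → ((1F * a) + (0F * c)) ≡ a
  unit₁ = from-yes (∀? λ a → ∀? λ c → (1F * a) + (0F * c) ≟ a)
  unit₂ : ∀ a c → ((0F * a) + (1F * c)) ≡ c
  unit₂ = from-yes (∀? λ a → ∀? λ c → (0F * a) + (1F * c) ≟ c)

·-identityʳ : ∀ P → P · Id ≡ P
·-identityʳ (mat a b c d) = mat-cong (unit₁ a b) (unit₂ a b) (unit₁ c d) (unit₂ c d)
  where
  unit₁ : ∀ a b → ((a * 1F) + (b * 0F)) ≡ a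
  unit₁ = from-yes (∀? λ a → ∀? λ b → (a * 1F) + (b * 0F) ≟ a)
  unit₂ : ∀ a b → ((a * 0F) + (b * 1F)) ≡ b
  unit₂ = from-yes (∀? λ a → ∀? λ b → (a * 0F) + (b * 1F) ≟ b)

m12-·A : ∀ P x → Mat2.m12 (P · A x) ≡ - Mat2.m11 P
m12-·A (mat a b _ _) _ = from-yes (∀? λ a → ∀? λ b → (a * (- 1F)) + (b * 0F) ≟ - a) a b

det : Mat2 → F9
det (mat a b c d) = (a * d) + (- (b * c))

det-· : ∀ P Q → det (P · Q) ≡ det P * det Q
det-· (mat a b c d) (mat e f g h) = expand a b c d e f g h
  where
  expand : ∀ a b c d e f g h →
           ((((a * e) + (b * g)) * ((c * f) + (d * h))) + (- (((a * f) + (b * h)) * ((c * e) + (d * g)))))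
           ≡ (((a * d) + (- (b * c))) * ((e * h) + (- (f * g))))
  expand = solve-∀ F9-ring

det-A : ∀ x → det (A x) ≡ 1F
det-A = from-yes (∀? λ x → det (A x) ≟ 1F)

row₁ row₂ : Mat2 → F9 × F9
row₁ P = Mat2.m11 P , Mat2.m12 P
row₂ P = Mat2.m21 P , Mat2.m22 P

row₂-A· : ∀ x P → row₂ (A x · P) ≡ row₁ P
row₂-A· x P = cong row₁ (·-identityˡ P)

_⋆_ : F9 → F9 × F9 → F9 × F9
σ ⋆ (a , b) = σ * a , σ * b

scaled-row₂⇒row₂≡[0,σ] : ∀ S P σ → det P ≡ 1F → row₂ (S · P) ≡ σ ⋆ row₂ P → row₂ S ≡ (0F , σ)
scaled-row₂⇒row₂≡[0,σ] (mat _ _ g h) (mat a b c d) σ detP rows = cong₂ _,_ g≡0 h≡σ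
  where
  open ≡-Reasoning
  row₂₁ : (g * a) + (h * c) ≡ σ * c
  row₂₁ = cong proj₁ rows
  row₂₂ : (g * b) + (h * d) ≡ σ * d
  row₂₂ = cong proj₂ rows
  -- Cramer's rule for (g, h) · P = σ (c, d), using det P = 1.
  cramer₁ : ∀ a b c d g h → (g * ((a * d) + (- (b * c))))
                            ≡ ((d * ((g * a) + (h * c))) + (- (c * ((g * b) + (h * d)))))
  cramer₁ = solve-∀ F9-ring
  cramer₂ : ∀ a b c d g h → (h * ((a * d) + (- (b * c))))
                            ≡ ((a * ((g * b) + (h * d))) + (- (b * ((g * a) + (h * c)))))
  cramer₂ = solve-∀ F9-ring
  cancel-σ : ∀ c d σ → ((d * (σ * c)) + (- (c * (σ * d)))) ≡ 0F
  cancel-σ = solve-∀ F9-ring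
  pull-σ : ∀ a b c d σ → ((a * (σ * d)) + (- (b * (σ * c)))) ≡ (σ * ((a * d) + (- (b * c))))
  pull-σ = solve-∀ F9-ring
  g≡0 : g ≡ 0F
  g≡0 = begin
    g                                   ≡⟨ sym (*-identityʳ g) ⟩
    g * 1F                              ≡⟨ cong (g *_) (sym detP) ⟩
    g * ((a * d) + (- (b * c)))         ≡⟨ cramer₁ a b c d g h ⟩
    (d * ((g * a) + (h * c))) + (- (c * ((g * b) + (h * d))))
                                        ≡⟨ cong₂ (λ u v → (d * u) + (- (c * v))) row₂₁ row₂₂ ⟩
    (d * (σ * c)) + (- (c * (σ * d)))   ≡⟨ cancel-σ c d σ ⟩
    0F                                  ∎
  h≡σ : h ≡ σ
  h≡σ = begin
    h                                   ≡⟨ sym (*-identityʳ h) ⟩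
    h * 1F                              ≡⟨ cong (h *_) (sym detP) ⟩
    h * ((a * d) + (- (b * c)))         ≡⟨ cramer₂ a b c d g h ⟩
    (a * ((g * b) + (h * d))) + (- (b * ((g * a) + (h * c))))
                                        ≡⟨ cong₂ (λ u v → (a * u) + (- (b * v))) row₂₂ row₂₁ ⟩
    (a * (σ * d)) + (- (b * (σ * c)))   ≡⟨ pull-σ a b c d σ ⟩
    σ * ((a * d) + (- (b * c)))         ≡⟨ cong (σ *_) detP ⟩
    σ * 1F                              ≡⟨ *-identityʳ σ ⟩
    σ                                   ∎

row₂≡[0,σ]⇒m11≡σ : ∀ S σ → det S ≡ 1F → σ * σ ≡ 1F → row₂ S ≡ (0F , σ) → Mat2.m11 S ≡ σ
row₂≡[0,σ]⇒m11≡σ (mat e f _ _) σ detS σ² refl = begin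
  e                              ≡⟨ sym (*-identityʳ e) ⟩
  e * 1F                         ≡⟨ cong (e *_) (sym σ²) ⟩
  e * (σ * σ)                    ≡⟨ regroup e f σ ⟩
  σ * ((e * σ) + (- (f * 0F)))   ≡⟨ cong (σ *_) detS ⟩
  σ * 1F                         ≡⟨ *-identityʳ σ ⟩
  σ                              ∎
  where
  open ≡-Reasoning
  regroup : ∀ e f σ → (e * (σ * σ)) ≡ (σ * ((e * σ) + (- (f * 0F))))
  regroup = solve-∀ F9-ring

M-++ : ∀ xs ys → M (xs ++ ys) ≡ M ys · M xs
M-++ []       ys = sym (·-identityʳ (M ys))
M-++ (x ∷ xs) ys = begin
  M (xs ++ ys) · A x   ≡⟨ cong (_· A x) (M-++ xs ys) ⟩
  (M ys · M xs) · A x  ≡⟨ ·-assoc (M ys) (M xs) (A x) ⟩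
  M ys · (M xs · A x)  ∎
  where open ≡-Reasoning

M-[_] : ∀ x → M (x ∷ []) ≡ A x
M-[ x ] = ·-identityˡ (A x)

M-∷-∷ʳ : ∀ x s y → M (x ∷ s ∷ʳ y) ≡ (A y · M s) · A x
M-∷-∷ʳ x s y = cong (_· A x) (trans (M-++ s (y ∷ [])) (cong (_· M s) M-[ y ]))

det-M : ∀ xs → det (M xs) ≡ 1F
det-M []       = refl
det-M (x ∷ xs) = begin
  det (M xs · A x)        ≡⟨ det-· (M xs) (A x) ⟩
  det (M xs) * det (A x)  ≡⟨ cong₂ _*_ (det-M xs) (det-A x) ⟩
  1F * 1F                 ≡⟨⟩
  1F                      ∎
  where open ≡-Reasoning

IsSignedId : Mat2 → Set
IsSignedId P = (P ≡ Id) ⊎ (P ≡ -Id)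

sandwich-m11≡1 : ∀ f g h → det (mat 1F f g h) ≡ 1F → (A g · mat 1F f g h) · A (- f) ≡ -Id
sandwich-m11≡1 = from-yes (∀? λ f → ∀? λ g → ∀? λ h →
  det (mat 1F f g h) ≟ 1F →-dec (A g · mat 1F f g h) · A (- f) ≟ᴹ -Id)

sandwich-m11≡-1 : ∀ f g h → det (mat (- 1F) f g h) ≡ 1F → (A (- g) · mat (- 1F) f g h) · A f ≡ Id
sandwich-m11≡-1 = from-yes (∀? λ f → ∀? λ g → ∀? λ h →
  det (mat (- 1F) f g h) ≟ 1F →-dec (A (- g) · mat (- 1F) f g h) · A f ≟ᴹ Id)

sandwich : ∀ S → det S ≡ 1F → IsSign (Mat2.m11 S) → ∃₂ λ x y → IsSignedId ((A y · S) · A x)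
sandwich (mat _ f g h) det≡1 (inj₁ refl) = - f , g , inj₂ (sandwich-m11≡1 f g h det≡1)
sandwich (mat _ f g h) det≡1 (inj₂ refl) = f , - g , inj₁ (sandwich-m11≡-1 f g h det≡1)

extend-to-quiddity : ∀ s → IsSign (Mat2.m11 (M s)) → ∃₂ λ x y → IsQuiddity (x ∷ s ∷ʳ y)
extend-to-quiddity s sign with sandwich (M s) (det-M s) sign
... | x , y , ±Id = x , y , subst IsSignedId (sym (M-∷-∷ʳ x s y)) ±Id

take-+ : ∀ m n (xs : List X) → take (m ℕ.+ n) xs ≡ take m xs ++ take n (drop m xs)
take-+ zero    n xs       = refl
take-+ (suc m) n []       = sym (take-[] n)
take-+ (suc m) n (x ∷ xs) = cong (x ∷_) (take-+ m n xs)

take-length-++ : ∀ (xs ys : List X) → take (length xs) (xs ++ ys) ≡ xs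
take-length-++ []       ys = refl
take-length-++ (x ∷ xs) ys = cong (x ∷_) (take-length-++ xs ys)

drop-length-++ : ∀ (xs ys : List X) → drop (length xs) (xs ++ ys) ≡ ys
drop-length-++ []       ys = refl
drop-length-++ (x ∷ xs) ys = drop-length-++ xs ys

length-drop-≥ : ∀ m {n} (xs : List X) → m ℕ.+ n ≤ length xs → n ≤ length (drop m xs)
length-drop-≥ zero    xs       fits       = fits
length-drop-≥ (suc m) (x ∷ xs) (s≤s fits) = length-drop-≥ m xs fits

∷-as-∷ʳ : ∀ (x : X) xs → ∃₂ λ ys y → x ∷ xs ≡ ys ∷ʳ y
∷-as-∷ʳ x []        = [] , x , refl
∷-as-∷ʳ x (x′ ∷ xs) with ∷-as-∷ʳ x′ xs
... | ys , y , eq = x ∷ ys , y , cong (x ∷_) eq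

toList-∷-∷ʳ : ∀ (x : X) s y → toList (x ∷ᵥ (fromList s ∷ʳᵥ y)) ≡ x ∷ s ∷ʳ y
toList-∷-∷ʳ x s y = cong (x ∷_) (trans (toList-∷ʳ y (fromList s)) (cong (_∷ʳ y) (toList∘fromList s)))

∼-swap : ∀ xs ys → (xs ++ ys) ∼ (ys ++ xs)
∼-swap xs ys = length xs , length-++-≤ˡ xs ,
  inj₁ (sym (cong₂ _++_ (drop-length-++ xs ys) (take-length-++ xs ys)))

⊕-fromList : ∀ u v w x s y →
             (u ∷ᵥ (fromList v ∷ʳᵥ w)) ⊕ (x ∷ᵥ (fromList s ∷ʳᵥ y)) ≡ (u + y) ∷ v ++ (w + x) ∷ s
⊕-fromList u v w x s y =
  cong₂ _∷_ (cong (u +_) (last-∷ʳ y (x ∷ᵥ fromList s)))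
            (cong₂ _++_ (trans (cong toList (init-∷ʳ w (fromList v))) (toList∘fromList v))
                        (cong₂ _∷_ (cong (_+ x) (last-∷ʳ w (u ∷ᵥ fromList v)))
                                   (trans (cong toList (init-∷ʳ y (fromList s))) (toList∘fromList s))))

reducible-of-quiddity-extension : ∀ pre s r x y → 1 ≤ length s → 3 ≤ length r →
                                  IsQuiddity (x ∷ s ∷ʳ y) → Reducible (pre ++ s ++ r)
reducible-of-quiddity-extension pre s@(_ ∷ s′) r@(r₁ ∷ r₂ ∷ r₃ ∷ rs) x y _ _ quiddity
  with ∷-as-∷ʳ r₃ (rs ++ pre)
... | mid , t , r₃∷rs++pre≡ =
  length mid , length s′ , a , b ,
  subst IsQuiddity (sym (toList-∷-∷ʳ x s y)) quiddity ,
  subst ((pre ++ s ++ r) ∼_) (sym a⊕b) (subst (_∼ (r ++ pre ++ s)) (++-assoc pre s r) (∼-swap (pre ++ s) r))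
  where
  a : Vec F9 (suc (suc (suc (length mid))))
  a = (r₁ + (- y)) ∷ᵥ (fromList (r₂ ∷ mid) ∷ʳᵥ (t + (- x)))
  b : Vec F9 (suc (suc (suc (length s′))))
  b = x ∷ᵥ (fromList s ∷ʳᵥ y)
  a⊕b : a ⊕ b ≡ r ++ pre ++ s
  a⊕b = begin
    a ⊕ b                               ≡⟨ ⊕-fromList (r₁ + (- y)) (r₂ ∷ mid) (t + (- x)) x s y ⟩
    ((r₁ + (- y)) + y) ∷ r₂ ∷ mid ++ ((t + (- x)) + x) ∷ s
                                        ≡⟨ cong₂ (λ u v → u ∷ r₂ ∷ mid ++ v ∷ s) ([u-v]+v≡u r₁ y) ([u-v]+v≡u t x) ⟩
    r₁ ∷ r₂ ∷ mid ++ t ∷ s              ≡⟨ cong (λ l → r₁ ∷ r₂ ∷ l) (sym (++-assoc mid (t ∷ []) s)) ⟩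
    r₁ ∷ r₂ ∷ (mid ∷ʳ t) ++ s           ≡⟨ cong (λ l → r₁ ∷ r₂ ∷ l ++ s) (sym r₃∷rs++pre≡) ⟩
    r₁ ∷ r₂ ∷ (r₃ ∷ rs ++ pre) ++ s     ≡⟨ cong (λ l → r₁ ∷ r₂ ∷ r₃ ∷ l) (++-assoc rs pre s) ⟩
    r ++ pre ++ s                       ∎
    where open ≡-Reasoning
reducible-of-quiddity-extension _ []      _            _ _ () _ _
reducible-of-quiddity-extension _ (_ ∷ _) []           _ _ _ () _
reducible-of-quiddity-extension _ (_ ∷ _) (_ ∷ [])     _ _ _ (s≤s ()) _
reducible-of-quiddity-extension _ (_ ∷ _) (_ ∷ _ ∷ []) _ _ _ (s≤s (s≤s ())) _

reducible-of-segment : ∀ pre s r → 1 ≤ length s → 3 ≤ length r →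
                       IsSign (Mat2.m11 (M s)) → Reducible (pre ++ s ++ r)
reducible-of-segment pre s r s≥1 r≥3 sign =
  let x , y , quiddity = extend-to-quiddity s sign in
  reducible-of-quiddity-extension pre s r x y s≥1 r≥3 quiddity

reducible-of-window : ∀ c i k → i ℕ.+ (suc k ℕ.+ 3) ≤ length c →
                      IsSign (Mat2.m11 (M (take (suc k) (drop i c)))) → Reducible c
reducible-of-window c i k fits sign =
  subst Reducible split
    (reducible-of-segment (take i c) (take (suc k) rest) (drop (suc k) rest)
                          (window≥1 rest rest-fits) (length-drop-≥ (suc k) rest rest-fits) sign)
  where
  rest = drop i c
  rest-fits = length-drop-≥ i c fits
  split : take i c ++ take (suc k) rest ++ drop (suc k) rest ≡ c
  split = trans (cong (take i c ++_) (take++drop≡id (suc k) rest)) (take++drop≡id i c)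
  window≥1 : ∀ xs → suc k ℕ.+ 3 ≤ length xs → 1 ≤ length (take (suc k) xs)
  window≥1 (_ ∷ _) _ = s≤s z≤n

M-take-+ : ∀ m n c → M (take (m ℕ.+ n) c) ≡ M (take n (drop m c)) · M (take m c)
M-take-+ m n c = trans (cong M (take-+ m n c)) (M-++ (take m c) (take n (drop m c)))

M-take-suc : ∀ t c → suc t ≤ length c → ∃ λ x → M (take (suc t) c) ≡ A x · M (take t c)
M-take-suc zero    (x ∷ c) _ = x , trans M-[ x ] (sym (·-identityʳ (A x)))
M-take-suc (suc t) (y ∷ c) (s≤s fits) =
  let x , step = M-take-suc t c fits in
  x , (begin
    M (take (suc t) c) · A y    ≡⟨ cong (_· A y) step ⟩
    (A x · M (take t c)) · A y  ≡⟨ ·-assoc (A x) (M (take t c)) (A y) ⟩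
    A x · (M (take t c) · A y)  ∎)
  where open ≡-Reasoning

row₂-take-suc : ∀ t c → suc t ≤ length c → row₂ (M (take (suc t) c)) ≡ row₁ (M (take t c))
row₂-take-suc t c fits =
  let x , step = M-take-suc t c fits in
  trans (cong row₂ step) (row₂-A· x (M (take t c)))

HasSign : F9 × F9 → Set
HasSign (a , b) = IsSign a ⊎ IsSign b

hasSign? : ∀ p → Dec (HasSign p)
hasSign? (a , b) = isSign? a ⊎-dec isSign? b

reducible-of-prefix-m12 : ∀ c t → suc (suc t) ℕ.+ 3 ≤ length c →
                          IsSign (Mat2.m12 (M (take (suc (suc t)) c))) → Reducible c
reducible-of-prefix-m12 (x ∷ c) t fits sign =
  reducible-of-window (x ∷ c) 1 t fits (IsSign-neg (subst IsSign (m12-·A (M (take (suc t) c)) x) sign))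

reducible-of-signed-row₂ : ∀ c t → 3 ℕ.+ t ℕ.+ 3 ≤ length c →
                           HasSign (row₂ (M (take (3 ℕ.+ t) c))) → Reducible c
reducible-of-signed-row₂ c t fits signed
  with subst HasSign (row₂-take-suc (2 ℕ.+ t) c (≤-trans (m≤m+n _ 3) fits)) signed
... | inj₁ sign = reducible-of-window c 0 (suc t) (≤-trans (n≤1+n _) fits) sign
... | inj₂ sign = reducible-of-prefix-m12 c t (≤-trans (n≤1+n _) fits) sign

reducible-of-proportional-rows : ∀ c {t u σ} → t < u → u ℕ.+ 3 ≤ length c → IsSign σ →
                                 row₂ (M (take u c)) ≡ σ ⋆ row₂ (M (take t c)) → Reducible c
reducible-of-proportional-rows c {t} {σ = σ} t<u fits sign rows with m≤n⇒∃[o]m+o≡n t<u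
... | k , refl = reducible-of-window c t k window-fits (subst IsSign (sym m11≡σ) sign)
  where
  S = M (take (suc k) (drop t c))
  P = M (take t c)
  1+t+k≡t+1+k : suc t ℕ.+ k ≡ t ℕ.+ suc k
  1+t+k≡t+1+k = sym (+-suc t k)
  product : M (take (suc t ℕ.+ k) c) ≡ S · P
  product = trans (cong (λ n → M (take n c)) 1+t+k≡t+1+k) (M-take-+ t (suc k) c)
  m11≡σ : Mat2.m11 S ≡ σ
  m11≡σ = row₂≡[0,σ]⇒m11≡σ S σ (det-M (take (suc k) (drop t c))) (IsSign-square sign)
            (scaled-row₂⇒row₂≡[0,σ] S P σ (det-M (take t c)) (trans (cong row₂ (sym product)) rows))
  window-fits : t ℕ.+ (suc k ℕ.+ 3) ≤ length c
  window-fits = subst (_≤ length c) (trans (cong (ℕ._+ 3) 1+t+k≡t+1+k) (ℕₚ.+-assoc t (suc k) 3)) fits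

_≈±_ : F9 × F9 → F9 × F9 → Set
p ≈± q = ∃ λ σ → IsSign σ × q ≡ σ ⋆ p

_≈±?_ : ∀ p q → Dec (p ≈± q)
p ≈±? q = map′ (λ { (inj₁ q≡p) → 1F , inj₁ refl , q≡p ; (inj₂ q≡-p) → - 1F , inj₂ refl , q≡-p })
               (λ { (_ , inj₁ refl , q≡p) → inj₁ q≡p ; (_ , inj₂ refl , q≡-p) → inj₂ q≡-p })
               (≡-dec _≟_ _≟_ q (1F ⋆ p) ⊎-dec ≡-dec _≟_ _≟_ q ((- 1F) ⋆ p))

⋆-assoc : ∀ σ τ p → σ ⋆ (τ ⋆ p) ≡ (σ * τ) ⋆ p
⋆-assoc σ τ (a , b) = cong₂ _,_ (sym (*-assoc σ τ a)) (sym (*-assoc σ τ b))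

⋆-identityˡ : ∀ p → 1F ⋆ p ≡ p
⋆-identityˡ (a , b) = cong₂ _,_ (*-identityˡ a) (*-identityˡ b)

≈±-sym : ∀ {p q} → p ≈± q → q ≈± p
≈±-sym {p} (σ , sign , refl) = σ , sign , (begin
  p            ≡⟨ sym (⋆-identityˡ p) ⟩
  1F ⋆ p       ≡⟨ cong (_⋆ p) (sym (IsSign-square sign)) ⟩
  (σ * σ) ⋆ p  ≡⟨ sym (⋆-assoc σ σ p) ⟩
  σ ⋆ (σ ⋆ p)  ∎)
  where open ≡-Reasoning

≈±-trans : ∀ {p q r} → p ≈± q → q ≈± r → p ≈± r
≈±-trans {p} (σ , σ-sign , refl) (τ , τ-sign , refl) = τ * σ , IsSign-* τ-sign σ-sign , ⋆-assoc τ σ p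

nonSign⁺ : List F9
nonSign⁺ = (z0 +i z1) ∷ (z1 +i z1) ∷ (z1 +i z2) ∷ []

nonSign : List F9
nonSign = 0F ∷ nonSign⁺ ++ map -_ nonSign⁺

-- One pair from each class {p, −p} of pairs with entries in nonSign = 𝔽₉ ∖ {±1}:
-- 4 with first entry 0 and 3 · 7 others.
representatives : List (F9 × F9)
representatives = map (0F ,_) (0F ∷ nonSign⁺) ++ cartesianProduct nonSign⁺ nonSign

-- Pairs with an entry ±1 have no representative and get the junk class zero.
classOf : F9 × F9 → Fin 25
classOf p = fromMaybe zero (findIndex (p ≈±?_) representatives)

≈±-representative : ∀ p → ¬ HasSign p → p ≈± lookup representatives (classOf p)
≈±-representative (a , b) = from-yes (∀? λ a → ∀? λ b →
  ¬? (hasSign? (a , b)) →-dec (a , b) ≈±? lookup representatives (classOf (a , b))) a b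

classOf-sound : ∀ {p q} → ¬ HasSign p → ¬ HasSign q → classOf p ≡ classOf q → p ≈± q
classOf-sound {p} {q} p-unsigned q-unsigned same =
  ≈±-trans (≈±-representative p p-unsigned)
           (≈±-sym (subst (λ k → q ≈± lookup representatives k) (sym same) (≈±-representative q q-unsigned)))

rowClass : List F9 → Fin 26 → Fin 25
rowClass c n = classOf (row₂ (M (take (3 ℕ.+ toℕ n) c)))

3+n+3≤length : ∀ (c : List F9) (n : Fin 26) → 31 ≤ length c → 3 ℕ.+ toℕ n ℕ.+ 3 ≤ length c
3+n+3≤length c n long = ≤-trans (+-monoˡ-≤ 3 (+-monoʳ-≤ 3 (toℕ≤pred[n] n))) long

reducible-or-unsigned : ∀ c (n : Fin 26) → 31 ≤ length c →
                        Reducible c ⊎ ¬ HasSign (row₂ (M (take (3 ℕ.+ toℕ n) c)))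
reducible-or-unsigned c n long = case hasSign? (row₂ (M (take (3 ℕ.+ toℕ n) c))) of λ where
  (yes signed)  → inj₁ (reducible-of-signed-row₂ c (toℕ n) (3+n+3≤length c n long) signed)
  (no unsigned) → inj₂ unsigned

reducible-of-class-collision : ∀ c → 31 ≤ length c →
                               (∃₂ λ i j → i Fin.< j × rowClass c i ≡ rowClass c j) → Reducible c
reducible-of-class-collision c long (i , j , i<j , same)
  with reducible-or-unsigned c i long | reducible-or-unsigned c j long
... | inj₁ reducible  | _               = reducible
... | inj₂ _          | inj₁ reducible  = reducible
... | inj₂ i-unsigned | inj₂ j-unsigned =
  -- The implicit arguments are given explicitly: inferring them would make Agda evaluate classOf.
  let t = 3 ℕ.+ toℕ i
      u = 3 ℕ.+ toℕ j
      σ , sign , rows = classOf-sound {row₂ (M (take t c))} {row₂ (M (take u c))} i-unsigned j-unsigned same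
  in reducible-of-proportional-rows c {t} {u} {σ} (+-monoʳ-< 3 i<j) (3+n+3≤length c j long) sign rows

reducible-of-length≥31 : ∀ c → 31 ≤ length c → Reducible c
reducible-of-length≥31 c long = reducible-of-class-collision c long (pigeonhole (n<1+n 25) (rowClass c))

proposition3p2 : (c : List F9) → Irreducible c → length c ≤ 32
proposition3p2 c (_ , _ , irreducible) with 31 ≤? length c
... | yes long = ⊥-elim (irreducible (reducible-of-length≥31 c long))
... | no ¬long = ≤-trans (≤-pred (≰⇒> ¬long)) (m≤m+n 30 2)
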